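{- Let $m\ge1$, let $\Theta\subseteq\mathsf{FORM}_m$ be compatible, and let $\phi\in\mathsf{FORM}_m$. (i) For $\theta_1,\dots,\theta_k\in\Theta$: $\{\theta_1,\dots,\theta_k\}\models_\Diamond\phi$ iff $(\hat\theta_1\sqcap\dots\sqcap\hat\theta_k)\sqcup\hat\phi=\hat\phi$, where $\sqcup$ and $\sqcap$ are applied pointwise. (ii) For single formulas $\theta,\phi\in\mathsf{FORM}_m$: - $\theta\models_\Diamond\phi$ iff $\hat\theta\sqcup\hat\phi=\hat\phi$, i.e. iff the face $\hat\theta$ is contained in the face $\hat\phi$; - $\hat\theta=\hat\phi$ iff both $\theta\models_\Diamond\phi$ and $\phi\models_\Diamond\theta$.
   Context: Let $\mathfrak Z=\{0,1/2,1\}$, with the following binary operations. - $x\wedge y=\min(x,y)$. - $x\sqcup y=x$ if $x=y$, and $x\sqcup y=1/2$ otherwise. - $\partial(x,y)=1/2$ if $y=1/2$. If $y\in\{0,1\}$, then $\partial(x,y)=y$ when $x=y$, and $\partial(x,y)=1-y$ when $x\ne y$. - The partial operation $\sqcap$: $x\sqcap x=x$, $x\sqcap 1/2=1/2\sqcap x=x$, and $0\sqcap1$, $1\sqcap0$ are undefined. $\mathsf{FORM}_m$ is the set of formulas in variables $X_1,\dots,X_m$ and constants $0,1/2$ built with $\sqcup,\partial,\wedge$. Each formula gives $\hat\phi\colon\mathfrak Z^m\to\mathfrak Z$. Elements of $\mathfrak Z^{\mathfrak Z^m}$ are viewed as nonempty faces of the $3^m$-cube. A set $\Theta$ is incompatible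 if for some $v\in\mathfrak Z^m$ and $\theta_1,\theta_2\in\Theta$ one has $\{\hat\theta_1(v),\hat\theta_2(v)\}=\{0,1\}$; otherwise it is compatible. $\Theta\models_\Diamond\phi$ is defined as follows. - If $\Theta$ is incompatible, then $\Theta\models_\Diamond\phi$ for every $\phi$. - If $\Theta$ is compatible, then $\Theta\models_\Diamond\phi$ iff for every $v\in\mathfrak Z^m$ there is $\theta\in\Theta\cup\{1/2\}$ with $\hat\theta(v)\sqcup\hat\phi(v)=\hat\phi(v)$. -}

module Defs where

open import Data.Nat using (ℕ)
open import Data.Fin using (Fin)
open import Data.Maybe using (Maybe; just; nothing)
open import Data.List using (List; []; _∷_; map)
open import Data.Product using (Σ; _×_)
open import Data.Sum using (_⊎_)
open import Relation.Binary.PropositionalEquality using (_≡_)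
open import Relation.Nullary using (¬_)

data 𝔍 : Set where
  𝟎 ½ 𝟏 : 𝔍

_∧_ : 𝔍 → 𝔍 → 𝔍
𝟎 ∧ y = 𝟎
½ ∧ 𝟎 = 𝟎
½ ∧ y = ½
𝟏 ∧ y = y

_⊔_ : 𝔍 → 𝔍 → 𝔍
𝟎 ⊔ 𝟎 = 𝟎
𝟏 ⊔ 𝟏 = 𝟏
½ ⊔ ½ = ½
_ ⊔ _ = ½

∂ : 𝔍 → 𝔍 → 𝔍
∂ x ½ = ½
∂ 𝟎 𝟎 = 𝟎
∂ ½ 𝟎 = 𝟏
∂ 𝟏 𝟎 = 𝟏
∂ 𝟏 𝟏 = 𝟏
∂ ½ 𝟏 = 𝟎
∂ 𝟎 𝟏 = 𝟎

_⊓_ : 𝔍 → 𝔍 → Maybe 𝔍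
𝟎 ⊓ 𝟎 = just 𝟎
𝟎 ⊓ ½ = just 𝟎
𝟎 ⊓ 𝟏 = nothing
½ ⊓ y = just y
𝟏 ⊓ 𝟎 = nothing
𝟏 ⊓ ½ = just 𝟏
𝟏 ⊓ 𝟏 = just 𝟏

⊓* : 𝔍 → List 𝔍 → Maybe 𝔍
⊓* x [] = just x
⊓* x (y ∷ ys) with ⊓* y ys
... | nothing = nothing
... | just z  = x ⊓ z

_⊔ₘ_ : Maybe 𝔍 → 𝔍 → Maybe 𝔍
nothing ⊔ₘ y = nothing
just x  ⊔ₘ y = just (x ⊔ y)

data FORM (m : ℕ) : Set where
  X     : Fin m → FORM m
  c𝟎 c½ : FORM m
  _⊔'_  : FORM m → FORM m → FORM m
  ∂'    : FORM m → FORM m → FORM m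
  _∧'_  : FORM m → FORM m → FORM m

Val : ℕ → Set
Val m = Fin m → 𝔍

⟦_⟧ : ∀ {m} → FORM m → Val m → 𝔍
⟦ X i ⟧ v = v i
⟦ c𝟎 ⟧ v = 𝟎
⟦ c½ ⟧ v = ½
⟦ φ ⊔' ψ ⟧ v = ⟦ φ ⟧ v ⊔ ⟦ ψ ⟧ v
⟦ ∂' φ ψ ⟧ v = ∂ (⟦ φ ⟧ v) (⟦ ψ ⟧ v)
⟦ φ ∧' ψ ⟧ v = ⟦ φ ⟧ v ∧ ⟦ ψ ⟧ v

FSet : ℕ → Set₁
FSet m = FORM m → Set

Incompatible : ∀ {m} → FSet m → Set
Incompatible {m} Θ =
  Σ (Val m) λ v → Σ (FORM m) λ θ₁ → Σ (FORM m) λ θ₂ →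
    Θ θ₁ × Θ θ₂ × ((⟦ θ₁ ⟧ v ≡ 𝟎 × ⟦ θ₂ ⟧ v ≡ 𝟏) ⊎ (⟦ θ₁ ⟧ v ≡ 𝟏 × ⟦ θ₂ ⟧ v ≡ 𝟎))

Compatible : ∀ {m} → FSet m → Set
Compatible Θ = ¬ Incompatible Θ

_⊨◇_ : ∀ {m} → FSet m → FORM m → Set
_⊨◇_ {m} Θ φ =
  Incompatible Θ ⊎
  (Compatible Θ ×
   ((v : Val m) →
     (Σ (FORM m) λ θ → Θ θ × (⟦ θ ⟧ v ⊔ ⟦ φ ⟧ v ≡ ⟦ φ ⟧ v)) ⊎ (½ ⊔ ⟦ φ ⟧ v ≡ ⟦ φ ⟧ v)))

⟨_⟩ : ∀ {m} → FORM m → FSet m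
⟨ θ ⟩ ψ = ψ ≡ θ

-- Read 𝔍 as the faces of the segment [0,1] (½ is the whole segment, 0 and 1 its endpoints):
-- then a ⊔ b ≡ b says the face a lies in the face b, and ⊓ is intersection of faces, defined
-- when the faces meet.  Pointwise, a compatible list of values never contains both 0 and 1,
-- so its meet is defined, is one of the values, and lies below all of them.  Hence the meet
-- lies in the face φ̂(v) iff some θ̂(v), or ½, does, which is the pointwise content of ⊨◇.
module Submission where

open import Defs
open import Data.Nat using (ℕ; _≥_)
open import Data.Product using (_×_; Σ; _,_)
open import Data.Sum using (_⊎_; inj₁; inj₂)
open import Data.Empty using (⊥-elim)
open import Data.Maybe using (just)
open import Data.Maybe.Properties using (just-injective)
open import Data.List using (List; []; _∷_; map)
open import Data.List.Relation.Unary.All as All using (All)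
open import Data.List.Relation.Unary.Any using (here; there)
open import Data.List.Membership.Propositional using (_∈_)
open import Data.List.Membership.Propositional.Properties using (∈-map⁺; ∈-map⁻)
open import Data.List.Relation.Binary.Subset.Propositional using (_⊆_)
open import Function.Bundles using (_⇔_; mk⇔; module Equivalence)
open import Relation.Binary.PropositionalEquality using (_≡_; _≢_; refl; sym; trans; cong; subst)
open import Relation.Nullary using (¬_)

open Equivalence

𝟎≢𝟏 : 𝟎 ≢ 𝟏
𝟎≢𝟏 ()

infix 4 _⊑_

_⊑_ : 𝔍 → 𝔍 → Set
a ⊑ b = a ⊔ b ≡ b

⊑-refl : ∀ a → a ⊑ a
⊑-refl 𝟎 = refl
⊑-refl ½ = refl
⊑-refl 𝟏 = refl

⊑-½ : ∀ a → a ⊑ ½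
⊑-½ 𝟎 = refl
⊑-½ ½ = refl
⊑-½ 𝟏 = refl

⊑-inv : ∀ {a b} → a ⊑ b → a ≡ b ⊎ b ≡ ½
⊑-inv {𝟎} {𝟎} _ = inj₁ refl
⊑-inv {𝟎} {½} _ = inj₂ refl
⊑-inv {𝟎} {𝟏} ()
⊑-inv {½} {𝟎} ()
⊑-inv {½} {½} _ = inj₁ refl
⊑-inv {½} {𝟏} ()
⊑-inv {𝟏} {𝟎} ()
⊑-inv {𝟏} {½} _ = inj₂ refl
⊑-inv {𝟏} {𝟏} _ = inj₁ refl

⊑-trans : ∀ {a b c} → a ⊑ b → b ⊑ c → a ⊑ c
⊑-trans {a} a⊑b b⊑c with ⊑-inv b⊑c
... | inj₁ refl = a⊑b
... | inj₂ refl = ⊑-½ a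

⊑-antisym : ∀ {a b} → a ⊑ b → b ⊑ a → a ≡ b
⊑-antisym a⊑b b⊑a with ⊑-inv a⊑b | ⊑-inv b⊑a
... | inj₁ a≡b | _         = a≡b
... | inj₂ _   | inj₁ b≡a  = sym b≡a
... | inj₂ refl | inj₂ refl = refl

Consistent : List 𝔍 → Set
Consistent as = ¬ (𝟎 ∈ as × 𝟏 ∈ as)

consistent-⊆ : ∀ {as bs} → as ⊆ bs → Consistent bs → Consistent as
consistent-⊆ as⊆bs bs-consistent (𝟎∈ , 𝟏∈) = bs-consistent (as⊆bs 𝟎∈ , as⊆bs 𝟏∈)

⊓-glb : ∀ a b → Consistent (a ∷ b ∷ []) →
  Σ 𝔍 λ c → a ⊓ b ≡ just c × c ∈ a ∷ b ∷ [] × c ⊑ a × c ⊑ b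
⊓-glb 𝟎 𝟎 _ = 𝟎 , refl , here refl , refl , refl
⊓-glb 𝟎 ½ _ = 𝟎 , refl , here refl , refl , refl
⊓-glb 𝟎 𝟏 ab = ⊥-elim (ab (here refl , there (here refl)))
⊓-glb ½ b _ = b , refl , there (here refl) , ⊑-½ b , ⊑-refl b
⊓-glb 𝟏 𝟎 ab = ⊥-elim (ab (there (here refl) , here refl))
⊓-glb 𝟏 ½ _ = 𝟏 , refl , here refl , refl , refl
⊓-glb 𝟏 𝟏 _ = 𝟏 , refl , here refl , refl , refl

pair⊆ : ∀ {A : Set} {a b : A} {bs : List A} → b ∈ bs → a ∷ b ∷ [] ⊆ a ∷ bs
pair⊆ b∈ (here refl)         = here refl
pair⊆ b∈ (there (here refl)) = there b∈

⊓*-glb : ∀ a as → Consistent (a ∷ as) →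
  Σ 𝔍 λ c → ⊓* a as ≡ just c × c ∈ a ∷ as × All (c ⊑_) (a ∷ as)
⊓*-glb a [] _ = a , refl , here refl , ⊑-refl a All.∷ All.[]
⊓*-glb a (b ∷ bs) consistent
  with ⊓*-glb b bs (consistent-⊆ there consistent)
... | c′ , eq′ , c′∈ , c′⊑bs rewrite eq′
  with ⊓-glb a c′ (consistent-⊆ (pair⊆ c′∈) consistent)
...   | c , eq , c∈ , c⊑a , c⊑c′ =
  c , eq , pair⊆ c′∈ c∈ , c⊑a All.∷ All.map (⊑-trans c⊑c′) c′⊑bs

module _ {m : ℕ} where

  Covered : FSet m → FORM m → Val m → Set
  Covered Θ φ v = (Σ (FORM m) λ θ → Θ θ × ⟦ θ ⟧ v ⊑ ⟦ φ ⟧ v) ⊎ ½ ⊑ ⟦ φ ⟧ v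

  ⊨◇-pointwise : ∀ {Θ : FSet m} (φ : FORM m) {P : Val m → Set} → Compatible Θ →
    (∀ v → Covered Θ φ v ⇔ P v) → (Θ ⊨◇ φ) ⇔ (∀ v → P v)
  ⊨◇-pointwise φ compatible covered⇔P = mk⇔
    (λ { (inj₁ incompatible) → ⊥-elim (compatible incompatible)
       ; (inj₂ (_ , covered)) v → to (covered⇔P v) (covered v) })
    (λ p → inj₂ (compatible , λ v → from (covered⇔P v) (p v)))

  compatible-⊆ : ∀ {Θ Θ′ : FSet m} → (∀ {ψ} → Θ′ ψ → Θ ψ) → Compatible Θ → Compatible Θ′
  compatible-⊆ Θ′⊆Θ compatible (v , θ₁ , θ₂ , θ₁∈ , θ₂∈ , clash) =
    compatible (v , θ₁ , θ₂ , Θ′⊆Θ θ₁∈ , Θ′⊆Θ θ₂∈ , clash)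

  compatible⇒consistent : ∀ {θs : List (FORM m)} → Compatible (_∈ θs) →
    ∀ v → Consistent (map (λ ψ → ⟦ ψ ⟧ v) θs)
  compatible⇒consistent compatible v (𝟎∈ , 𝟏∈) with ∈-map⁻ _ 𝟎∈ | ∈-map⁻ _ 𝟏∈
  ... | θ₀ , θ₀∈ , θ₀≡𝟎 | θ₁ , θ₁∈ , θ₁≡𝟏 =
    compatible (v , θ₀ , θ₁ , θ₀∈ , θ₁∈ , inj₁ (sym θ₀≡𝟎 , sym θ₁≡𝟏))

  covered-∈⇔⊓* : ∀ φ θ θs v → Consistent (map (λ ψ → ⟦ ψ ⟧ v) (θ ∷ θs)) →
    Covered (_∈ θ ∷ θs) φ v ⇔
    (⊓* (⟦ θ ⟧ v) (map (λ ψ → ⟦ ψ ⟧ v) θs) ⊔ₘ ⟦ φ ⟧ v ≡ just (⟦ φ ⟧ v))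
  covered-∈⇔⊓* φ θ θs v consistent
    with ⊓*-glb (⟦ θ ⟧ v) (map (λ ψ → ⟦ ψ ⟧ v) θs) consistent
  ... | c , eq , c∈ , c⊑θs rewrite eq = mk⇔ covered⇒c⊑φ c⊑φ⇒covered
    where
    covered⇒c⊑φ : Covered (_∈ θ ∷ θs) φ v → just (c ⊔ ⟦ φ ⟧ v) ≡ just (⟦ φ ⟧ v)
    covered⇒c⊑φ (inj₁ (ψ , ψ∈ , ψ⊑φ)) = cong just (⊑-trans (All.lookup c⊑θs (∈-map⁺ _ ψ∈)) ψ⊑φ)
    covered⇒c⊑φ (inj₂ ½⊑φ)             = cong just (⊑-trans (⊑-½ c) ½⊑φ)
    c⊑φ⇒covered : just (c ⊔ ⟦ φ ⟧ v) ≡ just (⟦ φ ⟧ v) → Covered (_∈ θ ∷ θs) φ v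
    c⊑φ⇒covered c⊑φ with ∈-map⁻ _ c∈
    ... | ψ , ψ∈ , refl = inj₁ (ψ , ψ∈ , just-injective c⊑φ)

  ⊨◇-∈⇔⊓* : ∀ φ θ θs → Compatible (_∈ θ ∷ θs) →
    ((_∈ θ ∷ θs) ⊨◇ φ) ⇔
    (∀ v → ⊓* (⟦ θ ⟧ v) (map (λ ψ → ⟦ ψ ⟧ v) θs) ⊔ₘ ⟦ φ ⟧ v ≡ just (⟦ φ ⟧ v))
  ⊨◇-∈⇔⊓* φ θ θs compatible = ⊨◇-pointwise φ compatible λ v →
    covered-∈⇔⊓* φ θ θs v (compatible⇒consistent compatible v)

  ⟨⟩-compatible : (θ : FORM m) → Compatible ⟨ θ ⟩
  ⟨⟩-compatible θ (v , _ , _ , refl , refl , inj₁ (θ≡𝟎 , θ≡𝟏)) = 𝟎≢𝟏 (trans (sym θ≡𝟎) θ≡𝟏)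
  ⟨⟩-compatible θ (v , _ , _ , refl , refl , inj₂ (θ≡𝟏 , θ≡𝟎)) = 𝟎≢𝟏 (trans (sym θ≡𝟎) θ≡𝟏)

  ⊨◇-⟨⟩ : ∀ θ φ → (⟨ θ ⟩ ⊨◇ φ) ⇔ (∀ v → ⟦ θ ⟧ v ⊑ ⟦ φ ⟧ v)
  ⊨◇-⟨⟩ θ φ = ⊨◇-pointwise φ (⟨⟩-compatible θ) λ v → mk⇔
    (λ { (inj₁ (_ , refl , θ⊑φ)) → θ⊑φ ; (inj₂ ½⊑φ) → ⊑-trans (⊑-½ _) ½⊑φ })
    (λ θ⊑φ → inj₁ (θ , refl , θ⊑φ))

  ≗⇔⊨◇-both : ∀ θ φ → (∀ v → ⟦ θ ⟧ v ≡ ⟦ φ ⟧ v) ⇔ ((⟨ θ ⟩ ⊨◇ φ) × (⟨ φ ⟩ ⊨◇ θ))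
  ≗⇔⊨◇-both θ φ = mk⇔
    (λ θ≗φ → from (⊨◇-⟨⟩ θ φ) (λ v → subst (⟦ θ ⟧ v ⊑_) (θ≗φ v) (⊑-refl _))
           , from (⊨◇-⟨⟩ φ θ) (λ v → subst (⟦ φ ⟧ v ⊑_) (sym (θ≗φ v)) (⊑-refl _)))
    (λ (θ⊨φ , φ⊨θ) v → ⊑-antisym (to (⊨◇-⟨⟩ θ φ) θ⊨φ v) (to (⊨◇-⟨⟩ φ θ) φ⊨θ v))

proposition5p8 :
    (m : ℕ) → m ≥ 1 → (Θ : FSet m) → Compatible Θ → (φ : FORM m) →
    ((θ : FORM m) (θs : List (FORM m)) → All Θ (θ ∷ θs) →
      ((λ ψ → ψ ∈ (θ ∷ θs)) ⊨◇ φ) ⇔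
      ((v : Val m) → (⊓* (⟦ θ ⟧ v) (map (λ ψ → ⟦ ψ ⟧ v) θs) ⊔ₘ ⟦ φ ⟧ v) ≡ just (⟦ φ ⟧ v)))
    ×
    ((θ : FORM m) →
      ((⟨ θ ⟩ ⊨◇ φ) ⇔ ((v : Val m) → ⟦ θ ⟧ v ⊔ ⟦ φ ⟧ v ≡ ⟦ φ ⟧ v))
      ×
      (((v : Val m) → ⟦ θ ⟧ v ≡ ⟦ φ ⟧ v) ⇔ ((⟨ θ ⟩ ⊨◇ φ) × (⟨ φ ⟩ ⊨◇ θ))))
proposition5p8 m _ Θ compatible φ =
  (λ θ θs θs⊆Θ → ⊨◇-∈⇔⊓* φ θ θs (compatible-⊆ (All.lookup θs⊆Θ) compatible)) ,
  (λ θ → ⊨◇-⟨⟩ θ φ , ≗⇔⊨◇-both θ φ)
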